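{- Let $k\geq 2$ be an integer and, for $n\geq 0$, let $f_{k,n}$ denote the number of cyclic weakly even-up words over $k$ of length $n$. Let $F_k(x)=\sum_{n\geq 0}f_{k,n}x^n$. Then \[F_k(x)=\left\lfloor\frac{k}{2}\right\rfloor\frac{x}{1-x}+\frac{2(1-x)^{\lceil k/2\rceil}+\lceil k/2\rceil x-1}{(2-x)(1-x)^{\lceil k/2\rceil}+x-1}.\]
   Context: For an integer $k\geq 2$, let $[k]=\{1,\ldots,k\}$. A word over $k$ of length $n$ is an element $w_1\cdots w_n\in[k]^n$ (for $n=0$ there is exactly one word, the empty word, which is counted). A word $w_1\cdots w_n\in[k]^n$ is cyclic weakly even-up if for every $i\in[n]$, whenever $w_i$ is even, $w_{i+1}\geq w_i$, where $w_{n+1}$ is defined to be $w_1$. -}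

module Defs where

open import Data.Nat using (ℕ; zero; suc; _≤_; _≤?_; _∸_)
open import Data.Nat.Divisibility using (_∣_; _∣?_)
open import Data.Nat.DivMod using (_mod_)
open import Data.Fin using (Fin; toℕ)
open import Data.Fin.Properties using (all?)
open import Data.Vec using (Vec; []; _∷_; lookup)
open import Data.List using (List; [_]; map; concatMap; allFin; filter; length; foldr; upTo)
open import Data.Integer using (ℤ; +_; _+_; _*_; -_)
open import Data.Unit using (⊤; tt)
open import Relation.Nullary using (Dec; yes)
open import Relation.Nullary.Decidable using (_→-dec_)

-- A letter a : Fin k represents the value  suc (toℕ a)  in [k] = {1,…,k}.
val : ∀ {k} → Fin k → ℕ
val a = suc (toℕ a)

Word : ℕ → ℕ → Set
Word k n = Vec (Fin k) n

CWEU : ∀ {k n} → Word k n → Set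
CWEU {k} {zero} w = ⊤
CWEU {k} {suc m} w =
  ∀ (i : Fin (suc m)) →
    2 ∣ val (lookup w i) →
    val (lookup w i) ≤ val (lookup w (suc (toℕ i) mod suc m))

cweu? : ∀ {k n} (w : Word k n) → Dec (CWEU w)
cweu? {k} {zero} w = yes tt
cweu? {k} {suc m} w = all? λ i →
  (2 ∣? val (lookup w i)) →-dec (val (lookup w i) ≤? val (lookup w (suc (toℕ i) mod suc m)))

allWords : ∀ k n → List (Word k n)
allWords k zero = [ [] ]
allWords k (suc n) = concatMap (λ a → map (a ∷_) (allWords k n)) (allFin k)

f : ℕ → ℕ → ℕ
f k n = length (filter cweu? (allWords k n))

PS : Set
PS = ℕ → ℤ

_⊛_ : PS → PS → PS
(a ⊛ b) n = foldr _+_ (+ 0) (map (λ i → a i * b (n ∸ i)) (upTo (suc n)))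

_⊕_ : PS → PS → PS
(a ⊕ b) n = a n + b n

const : ℤ → PS
const c zero = c
const c (suc n) = + 0

X : PS
X zero = + 0
X (suc zero) = + 1
X (suc (suc n)) = + 0

scale : ℤ → PS → PS
scale c a n = c * a n

_^ps_ : PS → ℕ → PS
a ^ps zero = const (+ 1)
a ^ps suc m = a ⊛ (a ^ps m)

F : ℕ → PS
F k n = + f k n

oneMinusX : PS
oneMinusX = const (+ 1) ⊕ scale (- (+ 1)) X

Num : ℕ → PS
Num c = (scale (+ 2) (oneMinusX ^ps c) ⊕ scale (+ c) X) ⊕ const (- (+ 1))

Den : ℕ → PS
Den c = (((const (+ 2) ⊕ scale (- (+ 1)) X) ⊛ (oneMinusX ^ps c)) ⊕ X) ⊕ const (- (+ 1))

{-# OPTIONS --safe #-}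
module Submission where

-- A word is cyclic weakly even-up iff, read cyclically, every letter may be
-- followed by the next one, where b may follow a unless a is even and b < a.
-- So for n ≥ 1, f_{k,n} is the trace of Pⁿ for the 0/1 matrix P of this
-- relation, and F = 1 + x Σₐ G_aa where G_pz = Σₘ (Pᵐ⁺¹)_pz xᵐ.  Fix the end
-- letter z, let S = Σ_b G_bz and H_p = Σ_{b<p} G_bz.  The first step of a walk
-- gives G_pz = 1 + x S for odd p and G_pz = [p ≤ z] + x (S - H_p) for even p.
-- Sweeping p upwards yields H_p = (1 - δ_p) S + η_p for explicit polynomials,
-- and H_k = S gives δ_k S = η_k.  This yields explicit δ_k G_aa = ω_a π_ak, so
-- δ_k F = δ_k + x R_k with R_k = Σ_a ω_a π_ak.  For k = 2c and k = 2c + 1 both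
-- δ_k and (1 - x) R_k are polynomials in x and (1 - x)^c, and δ_k is, up to a
-- factor 1 - x, the denominator in the theorem; what remains is a polynomial
-- identity.

open import Defs

open import Algebra.Bundles using (CommutativeRing)
open import Algebra.Structures using (IsCommutativeRing)
open import Algebra.Solver.Ring.AlmostCommutativeRing using (fromCommutativeRing; _-Raw-AlmostCommutative⟶_)
import Algebra.Solver.Ring as RingSolver
open import Data.Bool using (Bool; true; false; _∨_; T; if_then_else_)
open import Data.Bool.Properties using (T-≡)
open import Data.Integer using (ℤ; +_; _≟_)
import Data.Integer as ℤ
import Data.Integer.Properties as ℤ
open import Data.List using (foldr; map; applyUpTo)
open import Data.Maybe using (Maybe)
import Data.Maybe as Maybe
open import Data.Nat using (ℕ; zero; suc; _∸_; _≤_; _<_; _≤ᵇ_; z≤n; s≤s; ⌊_/2⌋; ⌈_/2⌉)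
import Data.Nat.Properties as ℕ
open import Data.Product using (_,_)
open import Function using (_∘_; Equivalence)
open import Relation.Binary.PropositionalEquality as ≡ using (_≡_; refl; cong; cong₂)
open import Relation.Nullary using (contradiction)
open import Relation.Nullary.Decidable using (dec⇒maybe)
open import Relation.Nullary.Reflects using (ofʸ; ofⁿ)

module FiniteSums where

  open import Data.Integer using (_+_; _*_)
  open ≡ using (sym; trans)
  open ≡.≡-Reasoning

  ∑ : ℕ → (ℕ → ℤ) → ℤ
  ∑ zero    g = + 0
  ∑ (suc n) g = g 0 + ∑ n (g ∘ suc)

  foldr-map-applyUpTo : ∀ n (g : ℕ → ℤ) (h : ℕ → ℕ) →
    foldr _+_ (+ 0) (map g (applyUpTo h n)) ≡ ∑ n (g ∘ h)
  foldr-map-applyUpTo zero    g h = refl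
  foldr-map-applyUpTo (suc n) g h = cong (_+_ (g (h 0))) (foldr-map-applyUpTo n g (h ∘ suc))

  ∑-cong : ∀ n {g h : ℕ → ℤ} → (∀ i → i < n → g i ≡ h i) → ∑ n g ≡ ∑ n h
  ∑-cong zero    e = refl
  ∑-cong (suc n) e = cong₂ _+_ (e 0 (s≤s z≤n)) (∑-cong n (λ i i<n → e (suc i) (s≤s i<n)))

  ∑-zero : ∀ n {g : ℕ → ℤ} → (∀ i → g i ≡ + 0) → ∑ n g ≡ + 0
  ∑-zero zero    e = refl
  ∑-zero (suc n) e = cong₂ _+_ (e 0) (∑-zero n (e ∘ suc))

  ∑-+ : ∀ n (g h : ℕ → ℤ) → ∑ n (λ i → g i + h i) ≡ ∑ n g + ∑ n h
  ∑-+ zero    g h = refl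
  ∑-+ (suc n) g h = trans (cong (_+_ (g 0 + h 0)) (∑-+ n (g ∘ suc) (h ∘ suc)))
                          (interchange (g 0) (h 0) _ _)
    where open import Algebra.Properties.CommutativeSemigroup ℤ.+-commutativeSemigroup using (interchange)

  ∑-*ˡ : ∀ n c (g : ℕ → ℤ) → c * ∑ n g ≡ ∑ n (λ i → c * g i)
  ∑-*ˡ zero    c g = ℤ.*-zeroʳ c
  ∑-*ˡ (suc n) c g = trans (ℤ.*-distribˡ-+ c (g 0) _) (cong (_+_ (c * g 0)) (∑-*ˡ n c (g ∘ suc)))

  ∑-*ʳ : ∀ n c (g : ℕ → ℤ) → ∑ n g * c ≡ ∑ n (λ i → g i * c)
  ∑-*ʳ zero    c g = ℤ.*-zeroˡ c
  ∑-*ʳ (suc n) c g = trans (ℤ.*-distribʳ-+ c (g 0) _) (cong (_+_ (g 0 * c)) (∑-*ʳ n c (g ∘ suc)))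

  ∑-snoc : ∀ n (g : ℕ → ℤ) → ∑ (suc n) g ≡ ∑ n g + g n
  ∑-snoc zero    g = trans (ℤ.+-identityʳ (g 0)) (sym (ℤ.+-identityˡ (g 0)))
  ∑-snoc (suc n) g = trans (cong (_+_ (g 0)) (∑-snoc n (g ∘ suc))) (sym (ℤ.+-assoc (g 0) _ _))

  ∑-reverse : ∀ n (g : ℕ → ℤ) → ∑ (suc n) g ≡ ∑ (suc n) (λ i → g (n ∸ i))
  ∑-reverse zero    g = refl
  ∑-reverse (suc n) g = begin
    g 0 + ∑ (suc n) (g ∘ suc)                 ≡⟨ cong (_+_ (g 0)) (∑-reverse n (g ∘ suc)) ⟩
    g 0 + ∑ (suc n) (λ i → g (suc (n ∸ i)))   ≡⟨ cong (_+_ (g 0)) (∑-cong (suc n) suc-∸) ⟩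
    g 0 + ∑ (suc n) (λ i → g (suc n ∸ i))     ≡⟨ ℤ.+-comm (g 0) _ ⟩
    ∑ (suc n) (λ i → g (suc n ∸ i)) + g 0     ≡⟨ cong (λ j → ∑ (suc n) (λ i → g (suc n ∸ i)) + g j) (sym (ℕ.n∸n≡0 n)) ⟩
    ∑ (suc n) (λ i → g (suc n ∸ i)) + g (n ∸ n)  ≡⟨ sym (∑-snoc (suc n) (λ i → g (suc n ∸ i))) ⟩
    ∑ (suc (suc n)) (λ i → g (suc n ∸ i))     ∎
    where
    suc-∸ : ∀ i → i < suc n → g (suc (n ∸ i)) ≡ g (suc n ∸ i)
    suc-∸ i i<1+n = cong g (sym (ℕ.+-∸-assoc 1 (ℕ.≤-pred i<1+n)))

  ∑-triangle : ∀ n (h : ℕ → ℕ → ℕ → ℤ) →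
    ∑ (suc n) (λ i → ∑ (suc i) (λ j → h j (i ∸ j) (n ∸ i)))
      ≡ ∑ (suc n) (λ j → ∑ (suc (n ∸ j)) (λ l → h j l (n ∸ j ∸ l)))
  ∑-triangle zero    h = refl
  ∑-triangle (suc n) h = begin
    (h 0 0 (suc n) + + 0) + ∑ (suc n) (λ i → h 0 (suc i) (n ∸ i) + inner i)
      ≡⟨ cong₂ _+_ (ℤ.+-identityʳ (h 0 0 (suc n))) (∑-+ (suc n) (λ i → h 0 (suc i) (n ∸ i)) inner) ⟩
    h 0 0 (suc n) + (first + ∑ (suc n) inner)
      ≡⟨ cong (λ s → h 0 0 (suc n) + (first + s)) (∑-triangle n (h ∘ suc)) ⟩
    h 0 0 (suc n) + (first + ∑ (suc n) (λ j → ∑ (suc (n ∸ j)) (λ l → h (suc j) l (n ∸ j ∸ l))))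
      ≡⟨ sym (ℤ.+-assoc (h 0 0 (suc n)) first _) ⟩
    (h 0 0 (suc n) + first) + ∑ (suc n) (λ j → ∑ (suc (n ∸ j)) (λ l → h (suc j) l (n ∸ j ∸ l))) ∎
    where
    inner : ℕ → ℤ
    inner i = ∑ (suc i) (λ j → h (suc j) (i ∸ j) (n ∸ i))
    first : ℤ
    first = ∑ (suc n) (λ i → h 0 (suc i) (n ∸ i))

module PowerSeries where

  open FiniteSums
  open import Data.Integer using (_+_; _*_; -_)
  open ≡ using (sym; trans)
  open ≡.≡-Reasoning

  ⊛-as-∑ : ∀ a b n → (a ⊛ b) n ≡ ∑ (suc n) (λ i → a i * b (n ∸ i))
  ⊛-as-∑ a b n = foldr-map-applyUpTo (suc n) (λ i → a i * b (n ∸ i)) (λ i → i)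

  ⊛-comm : ∀ a b n → (a ⊛ b) n ≡ (b ⊛ a) n
  ⊛-comm a b n = begin
    (a ⊛ b) n                                      ≡⟨ ⊛-as-∑ a b n ⟩
    ∑ (suc n) (λ i → a i * b (n ∸ i))              ≡⟨ ∑-reverse n (λ i → a i * b (n ∸ i)) ⟩
    ∑ (suc n) (λ i → a (n ∸ i) * b (n ∸ (n ∸ i)))  ≡⟨ ∑-cong (suc n) swap ⟩
    ∑ (suc n) (λ i → b i * a (n ∸ i))              ≡⟨ sym (⊛-as-∑ b a n) ⟩
    (b ⊛ a) n                                      ∎
    where
    swap : ∀ i → i < suc n → a (n ∸ i) * b (n ∸ (n ∸ i)) ≡ b i * a (n ∸ i)
    swap i i<1+n = trans (cong (λ j → a (n ∸ i) * b j) (ℕ.m∸[m∸n]≡n (ℕ.≤-pred i<1+n))) (ℤ.*-comm (a (n ∸ i)) (b i))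

  ⊛-assoc : ∀ a b c n → ((a ⊛ b) ⊛ c) n ≡ (a ⊛ (b ⊛ c)) n
  ⊛-assoc a b c n = begin
    ((a ⊛ b) ⊛ c) n
      ≡⟨ ⊛-as-∑ (a ⊛ b) c n ⟩
    ∑ (suc n) (λ i → (a ⊛ b) i * c (n ∸ i))
      ≡⟨ ∑-cong (suc n) (λ i _ → trans (cong (_* c (n ∸ i)) (⊛-as-∑ a b i))
                                       (∑-*ʳ (suc i) (c (n ∸ i)) (λ j → a j * b (i ∸ j)))) ⟩
    ∑ (suc n) (λ i → ∑ (suc i) (λ j → a j * b (i ∸ j) * c (n ∸ i)))
      ≡⟨ ∑-triangle n (λ j l r → a j * b l * c r) ⟩
    ∑ (suc n) (λ j → ∑ (suc (n ∸ j)) (λ l → a j * b l * c (n ∸ j ∸ l)))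
      ≡⟨ ∑-cong (suc n) (λ j _ → trans (∑-cong (suc (n ∸ j)) (λ l _ → ℤ.*-assoc (a j) (b l) (c (n ∸ j ∸ l))))
                                       (sym (∑-*ˡ (suc (n ∸ j)) (a j) (λ l → b l * c (n ∸ j ∸ l))))) ⟩
    ∑ (suc n) (λ j → a j * ∑ (suc (n ∸ j)) (λ l → b l * c (n ∸ j ∸ l)))
      ≡⟨ ∑-cong (suc n) (λ j _ → cong (a j *_) (sym (⊛-as-∑ b c (n ∸ j)))) ⟩
    ∑ (suc n) (λ j → a j * (b ⊛ c) (n ∸ j))
      ≡⟨ sym (⊛-as-∑ a (b ⊛ c) n) ⟩
    (a ⊛ (b ⊛ c)) n ∎

  ⊛-distribˡ-⊕ : ∀ a b c n → (a ⊛ (b ⊕ c)) n ≡ ((a ⊛ b) ⊕ (a ⊛ c)) n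
  ⊛-distribˡ-⊕ a b c n = begin
    (a ⊛ (b ⊕ c)) n
      ≡⟨ ⊛-as-∑ a (b ⊕ c) n ⟩
    ∑ (suc n) (λ i → a i * (b (n ∸ i) + c (n ∸ i)))
      ≡⟨ ∑-cong (suc n) (λ i _ → ℤ.*-distribˡ-+ (a i) (b (n ∸ i)) (c (n ∸ i))) ⟩
    ∑ (suc n) (λ i → a i * b (n ∸ i) + a i * c (n ∸ i))
      ≡⟨ ∑-+ (suc n) (λ i → a i * b (n ∸ i)) (λ i → a i * c (n ∸ i)) ⟩
    ∑ (suc n) (λ i → a i * b (n ∸ i)) + ∑ (suc n) (λ i → a i * c (n ∸ i))
      ≡⟨ sym (cong₂ _+_ (⊛-as-∑ a b n) (⊛-as-∑ a c n)) ⟩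
    ((a ⊛ b) ⊕ (a ⊛ c)) n ∎

  -- The ring operations on series are opaque and _≈_ is a record, so that
  -- unifying two ring expressions never unfolds a product into its sums.
  infix 4 _≈_
  record _≈_ (a b : PS) : Set where
    constructor coeffwise
    field coeff : ∀ n → a n ≡ b n
  open _≈_ public

  opaque
    infixl 6 _+ₚ_
    infixl 7 _*ₚ_
    infix  8 -ₚ_

    _+ₚ_ : PS → PS → PS
    _+ₚ_ = _⊕_

    _*ₚ_ : PS → PS → PS
    _*ₚ_ = _⊛_

    -ₚ_ : PS → PS
    (-ₚ a) n = - a n

  opaque
    unfolding _+ₚ_

    ⊕≡+ₚ : ∀ a b → a ⊕ b ≡ a +ₚ b
    ⊕≡+ₚ a b = refl

    ⊛≡*ₚ : ∀ a b → a ⊛ b ≡ a *ₚ b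
    ⊛≡*ₚ a b = refl

    +ₚ-coeff : ∀ a b n → (a +ₚ b) n ≡ a n + b n
    +ₚ-coeff a b n = refl

    const*ₚ-coeff : ∀ c a n → (const c *ₚ a) n ≡ c * a n
    const*ₚ-coeff c a n = begin
      (const c *ₚ a) n                            ≡⟨ ⊛-as-∑ (const c) a n ⟩
      c * a n + ∑ n (λ i → + 0 * a (n ∸ suc i))   ≡⟨ cong (_+_ (c * a n)) (∑-zero n (λ i → ℤ.*-zeroˡ (a (n ∸ suc i)))) ⟩
      c * a n + + 0                               ≡⟨ ℤ.+-identityʳ _ ⟩
      c * a n                                     ∎

    X*ₚ-coeff-suc : ∀ a n → (X *ₚ a) (suc n) ≡ a n
    X*ₚ-coeff-suc a n = begin
      (X *ₚ a) (suc n)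
        ≡⟨ ⊛-as-∑ X a (suc n) ⟩
      + 0 * a (suc n) + (+ 1 * a n + ∑ n (λ i → + 0 * a (n ∸ suc i)))
        ≡⟨ cong₂ (λ u v → u + (+ 1 * a n + v)) (ℤ.*-zeroˡ (a (suc n))) (∑-zero n (λ i → ℤ.*-zeroˡ (a (n ∸ suc i)))) ⟩
      + 0 + (+ 1 * a n + + 0)
        ≡⟨ trans (ℤ.+-identityˡ _) (trans (ℤ.+-identityʳ _) (ℤ.*-identityˡ (a n))) ⟩
      a n ∎

    ≈const+X* : ∀ {a b c} → a 0 ≡ c → (∀ n → a (suc n) ≡ b n) → a ≈ const c +ₚ X *ₚ b
    ≈const+X* {b = b} {c} a₀≡c a′≡b = coeffwise λ
      { zero    → trans a₀≡c (sym (ℤ.+-identityʳ c))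
      ; (suc n) → trans (a′≡b n) (sym (trans (ℤ.+-identityˡ _) (X*ₚ-coeff-suc b n))) }

    PS-isCommutativeRing : IsCommutativeRing _≈_ _+ₚ_ _*ₚ_ -ₚ_ (const (+ 0)) (const (+ 1))
    PS-isCommutativeRing = record
      { isRing = record
        { +-isAbelianGroup = record
          { isGroup = record
            { isMonoid = record
              { isSemigroup = record
                { isMagma = record
                  { isEquivalence = record
                    { refl  = coeffwise λ n → refl
                    ; sym   = λ e → coeffwise λ n → sym (coeff e n)
                    ; trans = λ e e′ → coeffwise λ n → trans (coeff e n) (coeff e′ n) }
                  ; ∙-cong = λ e e′ → coeffwise λ n → cong₂ _+_ (coeff e n) (coeff e′ n) }
                ; assoc = λ a b c → coeffwise λ n → ℤ.+-assoc (a n) (b n) (c n) }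
              ; identity = (λ a → coeffwise λ { zero → ℤ.+-identityˡ (a 0) ; (suc n) → ℤ.+-identityˡ (a (suc n)) })
                         , (λ a → coeffwise λ { zero → ℤ.+-identityʳ (a 0) ; (suc n) → ℤ.+-identityʳ (a (suc n)) }) }
            ; inverse = (λ a → coeffwise λ { zero → ℤ.+-inverseˡ (a 0) ; (suc n) → ℤ.+-inverseˡ (a (suc n)) })
                      , (λ a → coeffwise λ { zero → ℤ.+-inverseʳ (a 0) ; (suc n) → ℤ.+-inverseʳ (a (suc n)) })
            ; ⁻¹-cong = λ e → coeffwise λ n → cong -_ (coeff e n) }
          ; comm = λ a b → coeffwise λ n → ℤ.+-comm (a n) (b n) }
        ; *-cong = λ {a} {a′} {b} {b′} e e′ → coeffwise λ n →
            trans (⊛-as-∑ a b n) (trans (∑-cong (suc n) (λ i _ → cong₂ _*_ (coeff e i) (coeff e′ (n ∸ i))))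
                                        (sym (⊛-as-∑ a′ b′ n)))
        ; *-assoc = λ a b c → coeffwise (⊛-assoc a b c)
        ; *-identity = (λ a → coeffwise (identityˡ a)) , (λ a → coeffwise λ n → trans (⊛-comm a (const (+ 1)) n) (identityˡ a n))
        ; distrib = (λ a b c → coeffwise (⊛-distribˡ-⊕ a b c))
                  , (λ a b c → coeffwise λ n → trans (⊛-comm (b ⊕ c) a n)
                                  (trans (⊛-distribˡ-⊕ a b c n) (cong₂ _+_ (⊛-comm a b n) (⊛-comm a c n)))) }
      ; *-comm = λ a b → coeffwise (⊛-comm a b) }
      where
      identityˡ : ∀ a n → (const (+ 1) ⊛ a) n ≡ a n
      identityˡ a n = trans (const*ₚ-coeff (+ 1) a n) (ℤ.*-identityˡ (a n))

    const-+ₚ : ∀ a b → const (a + b) ≈ const a +ₚ const b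
    const-+ₚ a b = coeffwise λ { zero → refl ; (suc n) → refl }

    const-*ₚ : ∀ a b → const (a * b) ≈ const a *ₚ const b
    const-*ₚ a b = coeffwise λ { zero → sym (const*ₚ-coeff a (const b) 0)
                               ; (suc n) → sym (trans (const*ₚ-coeff a (const b) (suc n)) (ℤ.*-zeroʳ a)) }

    const--ₚ : ∀ a → const (- a) ≈ -ₚ const a
    const--ₚ a = coeffwise λ { zero → refl ; (suc n) → refl }

  PS-commutativeRing : CommutativeRing _ _
  PS-commutativeRing = record { isCommutativeRing = PS-isCommutativeRing }

  const-homomorphism : CommutativeRing.rawRing ℤ.+-*-commutativeRing -Raw-AlmostCommutative⟶ fromCommutativeRing PS-commutativeRing
  const-homomorphism = record
    { ⟦_⟧    = const
    ; +-homo = const-+ₚ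
    ; *-homo = const-*ₚ
    ; -‿homo = const--ₚ
    ; 0-homo = coeffwise λ { zero → refl ; (suc n) → refl }
    ; 1-homo = coeffwise λ { zero → refl ; (suc n) → refl } }

  const-≈? : (a b : ℤ) → Maybe (const a ≈ const b)
  const-≈? a b = Maybe.map (λ { refl → coeffwise λ n → refl }) (dec⇒maybe (a ≟ b))

  open RingSolver (CommutativeRing.rawRing ℤ.+-*-commutativeRing) (fromCommutativeRing PS-commutativeRing)
                  const-homomorphism const-≈? public
    using (solve; _:=_; _:+_; _:*_; _:-_; :-_; con)

module Walks where

  open FiniteSums
  open import Data.Fin using (Fin; toℕ; fromℕ; inject₁)
  import Data.Fin.Properties as Fin
  open import Data.Fin.Relation.Unary.Top using (view; ‵fromℕ; ‵inject₁)
  open import Data.List using (List; []; _∷_; _++_; concatMap; allFin; filter; length; tabulate)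
  import Data.List.Properties as List
  open import Data.List.Relation.Unary.All using (universal)
  open import Data.Nat using (_+_)
  open import Data.Nat.DivMod using (_mod_; _%_; n%n≡0; m<n⇒m%n≡m)
  open import Data.Nat.Divisibility using (_∣_; divides)
  open import Data.Nat.ListAction using (sum)
  open import Data.Product using (_×_; proj₁; proj₂)
  open import Data.Unit using (tt)
  open import Data.Vec using (Vec; _∷_; []; lookup; _∷ʳ_)
  open import Function using (_⇔_; mk⇔)
  open import Level using (0ℓ)
  open import Relation.Binary.PropositionalEquality using (sym; trans; module ≡-Reasoning)
  open import Relation.Nullary using (¬_; Dec; yes; no; does)
  open import Relation.Nullary.Decidable using (T?; _×-dec_)
  open import Relation.Unary using (Pred; Decidable)

  even : ℕ → Bool
  even zero          = true
  even (suc zero)    = false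
  even (suc (suc n)) = even n

  even⇒∤ : ∀ p → even p ≡ true → ¬ 2 ∣ suc p
  even⇒∤ zero          _ (divides (suc (suc q)) ())
  even⇒∤ (suc (suc p)) e (divides (suc q) eq) = even⇒∤ p e (divides q (ℕ.suc-injective (ℕ.suc-injective eq)))

  odd⇒∣ : ∀ p → even p ≡ false → 2 ∣ suc p
  odd⇒∣ (suc zero)    _ = divides 1 refl
  odd⇒∣ (suc (suc p)) e with odd⇒∣ p e
  ... | divides q eq = divides (suc q) (cong (suc ∘ suc) eq)

  -- Letters are indexed from 0: the index p stands for the value p + 1.  The
  -- letter p is free (even p, odd value) or restricted, and p ⇝ b says that b
  -- may follow p.
  _⇝_ : ℕ → ℕ → Bool
  p ⇝ b = even p ∨ (p ≤ᵇ b)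

  ⇝-correct : ∀ p b → (2 ∣ suc p → suc p ≤ suc b) ⇔ T (p ⇝ b)
  ⇝-correct p b with even p in e
  ... | true  = mk⇔ (λ _ → tt) (λ _ 2∣ → contradiction 2∣ (even⇒∤ p e))
  ... | false = mk⇔ (λ le → ℕ.≤⇒≤ᵇ (ℕ.≤-pred (le (odd⇒∣ p e)))) (λ le _ → s≤s (ℕ.≤ᵇ⇒≤ p b le))

  ⇝-free : ∀ p b → even p ≡ true → (p ⇝ b) ≡ true
  ⇝-free p b e = cong (_∨ (p ≤ᵇ b)) e

  ⇝-restricted : ∀ p b → even p ≡ false → (p ⇝ b) ≡ (p ≤ᵇ b)
  ⇝-restricted p b e = cong (_∨ (p ≤ᵇ b)) e

  Walk : ∀ {k m} → Fin k → Word k m → Fin k → Set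
  Walk a []      z = T (toℕ a ⇝ toℕ z)
  Walk a (b ∷ v) z = T (toℕ a ⇝ toℕ b) × Walk b v z

  walk? : ∀ {k m} (a z : Fin k) → Decidable (λ (v : Word k m) → Walk a v z)
  walk? a z []      = T? _
  walk? a z (b ∷ v) = T? _ ×-dec walk? b z v

  Walk⇔lookup : ∀ {k m} (a z : Fin k) (v : Word k m) →
    Walk a v z ⇔ (∀ i → T (toℕ (lookup (a ∷ v) i) ⇝ toℕ (lookup (v ∷ʳ z) i)))
  Walk⇔lookup a z v = mk⇔ (to a v) (from a v)
    where
    to : ∀ {m} a (v : Word _ m) → Walk a v z → ∀ i → T (toℕ (lookup (a ∷ v) i) ⇝ toℕ (lookup (v ∷ʳ z) i))
    to a []      s        Fin.zero    = s
    to a (b ∷ v) (s , _)  Fin.zero    = s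
    to a (b ∷ v) (_ , ss) (Fin.suc i) = to b v ss i
    from : ∀ {m} a (v : Word _ m) → (∀ i → T (toℕ (lookup (a ∷ v) i) ⇝ toℕ (lookup (v ∷ʳ z) i))) → Walk a v z
    from a []      h = h Fin.zero
    from a (b ∷ v) h = h Fin.zero , from b v (h ∘ Fin.suc)

  lookup-cyclic-successor : ∀ {A : Set} {m} (a : A) (v : Vec A m) (i : Fin (suc m)) →
    lookup (a ∷ v) (suc (toℕ i) mod suc m) ≡ lookup (v ∷ʳ a) i
  lookup-cyclic-successor {m = m} a v i with view i
  ... | ‵fromℕ = trans (cong (lookup (a ∷ v)) wraps) (sym (last v))
    where
    wraps : suc (toℕ (fromℕ m)) mod suc m ≡ Fin.zero
    wraps = Fin.toℕ-injective (trans (Fin.toℕ-fromℕ< _)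
              (trans (cong (λ j → suc j % suc m) (Fin.toℕ-fromℕ m)) (n%n≡0 (suc m))))
    last : ∀ {m} (v : Vec _ m) → lookup (v ∷ʳ a) (fromℕ m) ≡ a
    last []      = refl
    last (_ ∷ v) = last v
  ... | ‵inject₁ j = trans (cong (lookup (a ∷ v)) shifts) (sym (init v j))
    where
    shifts : suc (toℕ (inject₁ j)) mod suc m ≡ Fin.suc j
    shifts = Fin.toℕ-injective (trans (Fin.toℕ-fromℕ< _)
               (trans (cong (λ j → suc j % suc m) (Fin.toℕ-inject₁ j)) (m<n⇒m%n≡m (s≤s (Fin.toℕ<n j)))))
    init : ∀ {m} (v : Vec _ m) (j : Fin m) → lookup (v ∷ʳ a) (inject₁ j) ≡ lookup v j
    init (_ ∷ v) Fin.zero    = refl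
    init (_ ∷ v) (Fin.suc j) = init v j

  CWEU⇔Walk : ∀ {k m} (a : Fin k) (v : Word k m) → CWEU (a ∷ v) ⇔ Walk a v a
  CWEU⇔Walk {m = m} a v = mk⇔ (λ c → from (Walk⇔lookup a a v) (λ i → to (at i) (c i)))
                               (λ w i → from (at i) (to (Walk⇔lookup a a v) w i))
    where
    open Equivalence
    at : ∀ i → (2 ∣ val (lookup (a ∷ v) i) → val (lookup (a ∷ v) i) ≤ val (lookup (a ∷ v) (suc (toℕ i) mod suc m)))
               ⇔ T (toℕ (lookup (a ∷ v) i) ⇝ toℕ (lookup (v ∷ʳ a) i))
    at i rewrite lookup-cyclic-successor a v i = ⇝-correct _ _

  length-filter-concatMap : ∀ {A B : Set} {P : Pred B 0ℓ} (P? : Decidable P) (g : A → List B) xs →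
    length (filter P? (concatMap g xs)) ≡ sum (map (length ∘ filter P? ∘ g) xs)
  length-filter-concatMap P? g []       = refl
  length-filter-concatMap P? g (x ∷ xs) = begin
    length (filter P? (g x ++ concatMap g xs))
      ≡⟨ cong length (List.filter-++ P? (g x) (concatMap g xs)) ⟩
    length (filter P? (g x) ++ filter P? (concatMap g xs))
      ≡⟨ List.length-++ (filter P? (g x)) ⟩
    length (filter P? (g x)) + length (filter P? (concatMap g xs))
      ≡⟨ cong (_+_ (length (filter P? (g x)))) (length-filter-concatMap P? g xs) ⟩
    length (filter P? (g x)) + sum (map (length ∘ filter P? ∘ g) xs) ∎
    where open ≡-Reasoning

  length-filter-map : ∀ {A B : Set} {P : Pred B 0ℓ} (P? : Decidable P) (f : A → B) xs →
    length (filter P? (map f xs)) ≡ length (filter (P? ∘ f) xs)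
  length-filter-map P? f []       = refl
  length-filter-map P? f (x ∷ xs) with does (P? (f x))
  ... | true  = cong suc (length-filter-map P? f xs)
  ... | false = length-filter-map P? f xs

  length-filter-×-dec : ∀ {A S : Set} {R : Pred A 0ℓ} (S? : Dec S) (R? : Decidable R) xs →
    length (filter (λ x → S? ×-dec R? x) xs) ≡ (if does S? then length (filter R? xs) else 0)
  length-filter-×-dec (yes s) R? xs = cong length (List.filter-≐ _ R? (proj₂ , (s ,_)) xs)
  length-filter-×-dec (no ¬s) R? xs = cong length (List.filter-none _ (universal (λ _ → ¬s ∘ proj₁) xs))

  +-sum-allFin : ∀ k (h : Fin k → ℕ) (g : ℕ → ℤ) → (∀ i → + h i ≡ g (toℕ i)) →
    + sum (map h (allFin k)) ≡ ∑ k g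
  +-sum-allFin k h g h≗g = trans (cong (+_ ∘ sum) (List.map-tabulate (λ i → i) h)) (+-sum-tabulate k h g h≗g)
    where
    +-sum-tabulate : ∀ k (h : Fin k → ℕ) (g : ℕ → ℤ) → (∀ i → + h i ≡ g (toℕ i)) → + sum (tabulate h) ≡ ∑ k g
    +-sum-tabulate zero    h g h≗g = refl
    +-sum-tabulate (suc k) h g h≗g =
      trans (ℤ.pos-+ (h Fin.zero) _) (cong₂ ℤ._+_ (h≗g Fin.zero) (+-sum-tabulate k (h ∘ Fin.suc) (g ∘ suc) (h≗g ∘ Fin.suc)))

  indicator : Bool → ℤ
  indicator true  = + 1
  indicator false = + 0

  +-if : ∀ s n → + (if s then n else 0) ≡ indicator s ℤ.* + n
  +-if true  n = sym (ℤ.*-identityˡ (+ n))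
  +-if false n = refl

  walks : ℕ → ℕ → ℕ → PS
  walks k p z zero    = indicator (p ⇝ z)
  walks k p z (suc m) = ∑ k (λ b → indicator (p ⇝ b) ℤ.* walks k b z m)

  count-walks : ∀ {k} m (p z : Fin k) → + length (filter (walk? p z) (allWords k m)) ≡ walks k (toℕ p) (toℕ z) m
  count-walks zero p z with toℕ p ⇝ toℕ z
  ... | true  = refl
  ... | false = refl
  count-walks {k} (suc m) p z = begin
    + length (filter (walk? p z) (concatMap (λ b → map (b ∷_) (allWords k m)) (allFin k)))
      ≡⟨ cong +_ (length-filter-concatMap (walk? p z) (λ b → map (b ∷_) (allWords k m)) (allFin k)) ⟩
    + sum (map (λ b → length (filter (walk? p z) (map (b ∷_) (allWords k m)))) (allFin k))
      ≡⟨ +-sum-allFin k _ _ first-step ⟩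
    ∑ k (λ b → indicator (toℕ p ⇝ b) ℤ.* walks k b (toℕ z) m) ∎
    where
    open ≡-Reasoning
    first-step : ∀ b → + length (filter (walk? p z) (map (b ∷_) (allWords k m)))
                       ≡ indicator (toℕ p ⇝ toℕ b) ℤ.* walks k (toℕ b) (toℕ z) m
    first-step b = begin
      + length (filter (walk? p z) (map (b ∷_) (allWords k m)))
        ≡⟨ cong +_ (trans (length-filter-map (walk? p z) (b ∷_) (allWords k m))
                          (length-filter-×-dec (T? _) (walk? b z) (allWords k m))) ⟩
      + (if toℕ p ⇝ toℕ b then length (filter (walk? b z) (allWords k m)) else 0)
        ≡⟨ +-if (toℕ p ⇝ toℕ b) _ ⟩
      indicator (toℕ p ⇝ toℕ b) ℤ.* + length (filter (walk? b z) (allWords k m))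
        ≡⟨ cong (indicator (toℕ p ⇝ toℕ b) ℤ.*_) (count-walks m b z) ⟩
      indicator (toℕ p ⇝ toℕ b) ℤ.* walks k (toℕ b) (toℕ z) m ∎

  count-CWEU : ∀ k m → + f k (suc m) ≡ ∑ k (λ a → walks k a a m)
  count-CWEU k m = begin
    + length (filter cweu? (concatMap (λ a → map (a ∷_) (allWords k m)) (allFin k)))
      ≡⟨ cong +_ (length-filter-concatMap cweu? (λ a → map (a ∷_) (allWords k m)) (allFin k)) ⟩
    + sum (map (λ a → length (filter cweu? (map (a ∷_) (allWords k m)))) (allFin k))
      ≡⟨ +-sum-allFin k _ _ closed-walks ⟩
    ∑ k (λ a → walks k a a m) ∎
    where
    open ≡-Reasoning
    open Equivalence
    closed-walks : ∀ a → + length (filter cweu? (map (a ∷_) (allWords k m))) ≡ walks k (toℕ a) (toℕ a) m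
    closed-walks a = begin
      + length (filter cweu? (map (a ∷_) (allWords k m)))
        ≡⟨ cong +_ (length-filter-map cweu? (a ∷_) (allWords k m)) ⟩
      + length (filter (cweu? ∘ (a ∷_)) (allWords k m))
        ≡⟨ cong (+_ ∘ length) (List.filter-≐ _ (walk? a a) (to (CWEU⇔Walk a _) , from (CWEU⇔Walk a _)) (allWords k m)) ⟩
      + length (filter (walk? a a) (allWords k m))
        ≡⟨ count-walks m a a ⟩
      walks k (toℕ a) (toℕ a) m ∎

open FiniteSums
open PowerSeries
open Walks

open CommutativeRing PS-commutativeRing
  using ( _+_; _*_; -_; _-_; 0#; 1#; +-cong; +-congˡ; +-congʳ; *-cong; *-congˡ; *-congʳ; -‿cong
        ; *-identityˡ; *-identityʳ; +-identityʳ; zeroʳ; distribˡ; *-commutativeSemigroup; reflexive; setoid)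
  renaming (refl to ≈-refl; sym to ≈-sym; trans to ≈-trans)
open import Relation.Binary.Reasoning.Setoid setoid
open import Algebra.Properties.CommutativeSemigroup *-commutativeSemigroup using (x∙yz≈y∙xz)

∑ₚ : ℕ → (ℕ → PS) → PS
∑ₚ j g n = ∑ j (λ b → g b n)

∑ₚ-zero : ∀ g → ∑ₚ 0 g ≈ 0#
∑ₚ-zero g = coeffwise λ { zero → refl ; (suc n) → refl }

∑ₚ-cons : ∀ j g → ∑ₚ (suc j) g ≈ g 0 + ∑ₚ j (g ∘ suc)
∑ₚ-cons j g = coeffwise λ n → ≡.sym (+ₚ-coeff (g 0) (∑ₚ j (g ∘ suc)) n)

∑ₚ-snoc : ∀ j g → ∑ₚ (suc j) g ≈ ∑ₚ j g + g j
∑ₚ-snoc j g = coeffwise λ n → ≡.trans (∑-snoc j (λ b → g b n)) (≡.sym (+ₚ-coeff (∑ₚ j g) (g j) n))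

∑ₚ-cong : ∀ j {g h : ℕ → PS} → (∀ b → b < j → g b ≈ h b) → ∑ₚ j g ≈ ∑ₚ j h
∑ₚ-cong j g≈h = coeffwise λ n → ∑-cong j (λ b b<j → coeff (g≈h b b<j) n)

*-distribˡ-∑ₚ : ∀ j c g → c * ∑ₚ j g ≈ ∑ₚ j (λ b → c * g b)
*-distribˡ-∑ₚ zero    c g = ≈-trans (*-congˡ (∑ₚ-zero g)) (≈-trans (zeroʳ c) (≈-sym (∑ₚ-zero (λ b → c * g b))))
*-distribˡ-∑ₚ (suc j) c g = begin
  c * ∑ₚ (suc j) g                              ≈⟨ *-congˡ (∑ₚ-cons j g) ⟩
  c * (g 0 + ∑ₚ j (g ∘ suc))                    ≈⟨ distribˡ c (g 0) (∑ₚ j (g ∘ suc)) ⟩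
  c * g 0 + c * ∑ₚ j (g ∘ suc)                  ≈⟨ +-congˡ (*-distribˡ-∑ₚ j c (g ∘ suc)) ⟩
  c * g 0 + ∑ₚ j (λ b → c * g (suc b))          ≈⟨ ≈-sym (∑ₚ-cons j (λ b → c * g b)) ⟩
  ∑ₚ (suc j) (λ b → c * g b)                    ∎

∑ₚ-split : ∀ {p k} (g : ℕ → PS) → p ≤ k →
  ∑ₚ k (λ b → const (indicator (p ≤ᵇ b)) * g b) + ∑ₚ p g ≈ ∑ₚ k g
∑ₚ-split {zero} {k} g _ = begin
  ∑ₚ k (λ b → 1# * g b) + ∑ₚ 0 g   ≈⟨ +-cong (∑ₚ-cong k (λ b _ → *-identityˡ (g b))) (∑ₚ-zero g) ⟩
  ∑ₚ k g + 0#                      ≈⟨ +-identityʳ (∑ₚ k g) ⟩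
  ∑ₚ k g                           ∎
∑ₚ-split {suc p} {suc k} g (s≤s p≤k) = begin
  ∑ₚ (suc k) (λ b → const (indicator (suc p ≤ᵇ b)) * g b) + ∑ₚ (suc p) g
    ≈⟨ +-cong (∑ₚ-cons k (λ b → const (indicator (suc p ≤ᵇ b)) * g b)) (∑ₚ-cons p g) ⟩
  (0# * g 0 + ∑ₚ k (λ b → const (indicator (suc p ≤ᵇ suc b)) * g (suc b))) + (g 0 + ∑ₚ p (g ∘ suc))
    ≈⟨ +-congʳ (+-congˡ (∑ₚ-cong k (λ b _ → *-congʳ (reflexive (cong (const ∘ indicator) (≤ᵇ-suc p b)))))) ⟩
  (0# * g 0 + ∑ₚ k (λ b → const (indicator (p ≤ᵇ b)) * g (suc b))) + (g 0 + ∑ₚ p (g ∘ suc))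
    ≈⟨ solve 3 (λ g₀ u v → (con (+ 0) :* g₀ :+ u) :+ (g₀ :+ v) := g₀ :+ (u :+ v)) ≈-refl (g 0) _ _ ⟩
  g 0 + (∑ₚ k (λ b → const (indicator (p ≤ᵇ b)) * g (suc b)) + ∑ₚ p (g ∘ suc))
    ≈⟨ +-congˡ (∑ₚ-split (g ∘ suc) p≤k) ⟩
  g 0 + ∑ₚ k (g ∘ suc)
    ≈⟨ ≈-sym (∑ₚ-cons k g) ⟩
  ∑ₚ (suc k) g ∎
  where
  ≤ᵇ-suc : ∀ p b → (suc p ≤ᵇ suc b) ≡ (p ≤ᵇ b)
  ≤ᵇ-suc zero    b = refl
  ≤ᵇ-suc (suc p) b = refl

1-X : PS
1-X = 1# - X

-- The sweep over the letters (H-sweep) maintains H z p ≈ (1 - δ p) * S z + η z p,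
-- and π z t is the product of 1 - X over the restricted letters strictly between
-- z and t.
δ : ℕ → PS
δ zero    = 1#
δ (suc p) = if even p then δ p - X else 1-X * δ p

η : ℕ → ℕ → PS
η z zero    = 0#
η z (suc p) = if even p then η z p + 1# else 1-X * η z p + const (indicator (p ≤ᵇ z))

π : ℕ → ℕ → PS
π z zero    = 1#
π z (suc t) = if t ≤ᵇ z then 1# else (if even t then π z t else 1-X * π z t)

π≡1# : ∀ {z t} → t ≤ suc z → π z t ≡ 1#
π≡1# {t = zero}      _          = refl
π≡1# {z} {t = suc t} (s≤s t≤z) with t ≤ᵇ z | ℕ.≤ᵇ-reflects-≤ t z
... | true  | _        = refl
... | false | ofⁿ t≰z = contradiction t≤z t≰z

π-suc-free : ∀ {a t} → a < t → even t ≡ true → π a (suc t) ≡ π a t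
π-suc-free {a} {t} a<t e with t ≤ᵇ a | ℕ.≤ᵇ-reflects-≤ t a
... | true  | ofʸ t≤a = contradiction a<t (ℕ.≤⇒≯ t≤a)
... | false | _       rewrite e = refl

π-suc-restricted : ∀ {a t} → a < t → even t ≡ false → π a (suc t) ≡ 1-X * π a t
π-suc-restricted {a} {t} a<t e with t ≤ᵇ a | ℕ.≤ᵇ-reflects-≤ t a
... | true  | ofʸ t≤a = contradiction a<t (ℕ.≤⇒≯ t≤a)
... | false | _       rewrite e = refl

X*η : ∀ z t → X * η z t ≈ π z t - δ t
X*η-below : ∀ {z t} → t ≤ z → X * η z t ≈ 1# - δ t
X*η z zero = solve 1 (λ x → x :* con (+ 0) := con (+ 1) :- con (+ 1)) ≈-refl X
X*η z (suc t) with t ≤ᵇ z | ℕ.≤ᵇ-reflects-≤ t z | even t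
... | true | ofʸ t≤z | true = begin
  X * (η z t + 1#)          ≈⟨ solve 2 (λ x h → x :* (h :+ con (+ 1)) := x :* h :+ x) ≈-refl X (η z t) ⟩
  X * η z t + X             ≈⟨ +-congʳ (X*η-below t≤z) ⟩
  (1# - δ t) + X            ≈⟨ solve 2 (λ x d → (con (+ 1) :- d) :+ x := con (+ 1) :- (d :- x)) ≈-refl X (δ t) ⟩
  1# - (δ t - X)            ∎
... | true | ofʸ t≤z | false = begin
  X * (1-X * η z t + 1#)
    ≈⟨ solve 2 (λ x h → let y = con (+ 1) :- x in x :* (y :* h :+ con (+ 1)) := y :* (x :* h) :+ x) ≈-refl X (η z t) ⟩
  1-X * (X * η z t) + X     ≈⟨ +-congʳ (*-congˡ (X*η-below t≤z)) ⟩
  1-X * (1# - δ t) + X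
    ≈⟨ solve 2 (λ x d → let y = con (+ 1) :- x in y :* (con (+ 1) :- d) :+ x := con (+ 1) :- y :* d) ≈-refl X (δ t) ⟩
  1# - 1-X * δ t            ∎
... | false | _ | true = begin
  X * (η z t + 1#)          ≈⟨ solve 2 (λ x h → x :* (h :+ con (+ 1)) := x :* h :+ x) ≈-refl X (η z t) ⟩
  X * η z t + X             ≈⟨ +-congʳ (X*η z t) ⟩
  (π z t - δ t) + X         ≈⟨ solve 3 (λ x p d → (p :- d) :+ x := p :- (d :- x)) ≈-refl X (π z t) (δ t) ⟩
  π z t - (δ t - X)         ∎
... | false | _ | false = begin
  X * (1-X * η z t + 0#)    ≈⟨ solve 2 (λ x h → let y = con (+ 1) :- x in x :* (y :* h :+ con (+ 0)) := y :* (x :* h)) ≈-refl X (η z t) ⟩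
  1-X * (X * η z t)         ≈⟨ *-congˡ (X*η z t) ⟩
  1-X * (π z t - δ t)       ≈⟨ solve 3 (λ y p d → y :* (p :- d) := y :* p :- y :* d) ≈-refl 1-X (π z t) (δ t) ⟩
  1-X * π z t - 1-X * δ t   ∎

X*η-below {z} {t} t≤z = ≈-trans (X*η z t) (+-congʳ (reflexive (π≡1# (ℕ.m≤n⇒m≤1+n t≤z))))

ω : ℕ → PS
ω a = if even a then 1# else δ a

R : ℕ → PS
R t = ∑ₚ t (λ a → ω a * π a t)

module Sweep (k : ℕ) where

  S : ℕ → PS
  S z = ∑ₚ k (λ b → walks k b z)

  H : ℕ → ℕ → PS
  H z p = ∑ₚ p (λ b → walks k b z)

  walks-first-step : ∀ p z →
    walks k p z ≈ const (indicator (p ⇝ z)) + X * ∑ₚ k (λ b → const (indicator (p ⇝ b)) * walks k b z)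
  walks-first-step p z = ≈const+X* refl (λ m → ∑-cong k (λ b _ → ≡.sym (const*ₚ-coeff (indicator (p ⇝ b)) (walks k b z) m)))

  walks-free : ∀ {p} z → even p ≡ true → walks k p z ≈ 1# + X * S z
  walks-free {p} z e = begin
    walks k p z
      ≈⟨ walks-first-step p z ⟩
    const (indicator (p ⇝ z)) + X * ∑ₚ k (λ b → const (indicator (p ⇝ b)) * walks k b z)
      ≈⟨ +-cong (unit z) (*-congˡ (∑ₚ-cong k (λ b _ → ≈-trans (*-congʳ (unit b)) (*-identityˡ _)))) ⟩
    1# + X * S z ∎
    where
    unit : ∀ b → const (indicator (p ⇝ b)) ≈ 1#
    unit b = reflexive (cong (const ∘ indicator) (⇝-free p b e))

  walks-restricted : ∀ {p} z → even p ≡ false → p ≤ k →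
    walks k p z ≈ const (indicator (p ≤ᵇ z)) + X * (S z - H z p)
  walks-restricted {p} z e p≤k = begin
    walks k p z
      ≈⟨ walks-first-step p z ⟩
    const (indicator (p ⇝ z)) + X * ∑ₚ k (λ b → const (indicator (p ⇝ b)) * walks k b z)
      ≈⟨ +-cong (bracket z) (*-congˡ (∑ₚ-cong k (λ b _ → *-congʳ (bracket b)))) ⟩
    const (indicator (p ≤ᵇ z)) + X * A
      ≈⟨ +-congˡ (*-congˡ A≈S-H) ⟩
    const (indicator (p ≤ᵇ z)) + X * (S z - H z p) ∎
    where
    bracket : ∀ b → const (indicator (p ⇝ b)) ≈ const (indicator (p ≤ᵇ b))
    bracket b = reflexive (cong (const ∘ indicator) (⇝-restricted p b e))
    A : PS
    A = ∑ₚ k (λ b → const (indicator (p ≤ᵇ b)) * walks k b z)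
    A≈S-H : A ≈ S z - H z p
    A≈S-H = begin
      A                   ≈⟨ solve 2 (λ a h → a := (a :+ h) :- h) ≈-refl A (H z p) ⟩
      (A + H z p) - H z p ≈⟨ +-congʳ (∑ₚ-split (λ b → walks k b z) p≤k) ⟩
      S z - H z p         ∎

  H-sweep : ∀ z p → p ≤ k → H z p ≈ (1# - δ p) * S z + η z p
  H-sweep z zero _ = ≈-trans (∑ₚ-zero (λ b → walks k b z))
    (solve 1 (λ s → con (+ 0) := (con (+ 1) :- con (+ 1)) :* s :+ con (+ 0)) ≈-refl (S z))
  H-sweep z (suc p) 1+p≤k with even p in e
  ... | true = begin
    H z (suc p)                                        ≈⟨ ∑ₚ-snoc p (λ b → walks k b z) ⟩
    H z p + walks k p z                                ≈⟨ +-cong IH (walks-free z e) ⟩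
    ((1# - δ p) * S z + η z p) + (1# + X * S z)
      ≈⟨ solve 4 (λ d s h x → ((con (+ 1) :- d) :* s :+ h) :+ (con (+ 1) :+ x :* s)
                             := (con (+ 1) :- (d :- x)) :* s :+ (h :+ con (+ 1))) ≈-refl (δ p) (S z) (η z p) X ⟩
    (1# - (δ p - X)) * S z + (η z p + 1#)              ∎
    where
    IH = H-sweep z p (ℕ.<⇒≤ 1+p≤k)
  ... | false = begin
    H z (suc p)                                        ≈⟨ ∑ₚ-snoc p (λ b → walks k b z) ⟩
    H z p + walks k p z                                ≈⟨ +-cong IH (walks-restricted z e (ℕ.<⇒≤ 1+p≤k)) ⟩
    ((1# - δ p) * S z + η z p) + (ι + X * (S z - H z p))
      ≈⟨ +-congˡ (+-congˡ (*-congˡ (+-congˡ (-‿cong IH)))) ⟩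
    ((1# - δ p) * S z + η z p) + (ι + X * (S z - ((1# - δ p) * S z + η z p)))
      ≈⟨ solve 5 (λ d s h x i → let y = con (+ 1) :- x in
                     ((con (+ 1) :- d) :* s :+ h) :+ (i :+ x :* (s :- ((con (+ 1) :- d) :* s :+ h)))
                     := (con (+ 1) :- y :* d) :* s :+ (y :* h :+ i))
                   ≈-refl (δ p) (S z) (η z p) X ι ⟩
    (1# - 1-X * δ p) * S z + (1-X * η z p + ι)        ∎
    where
    IH = H-sweep z p (ℕ.<⇒≤ 1+p≤k)
    ι = const (indicator (p ≤ᵇ z))

  δ*S : ∀ z → δ k * S z ≈ η z k
  δ*S z = begin
    δ k * S z                                      ≈⟨ solve 2 (λ d s → d :* s := s :- (con (+ 1) :- d) :* s) ≈-refl (δ k) (S z) ⟩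
    S z - (1# - δ k) * S z                         ≈⟨ +-congʳ (H-sweep z k ℕ.≤-refl) ⟩
    ((1# - δ k) * S z + η z k) - (1# - δ k) * S z
      ≈⟨ solve 3 (λ d s h → ((con (+ 1) :- d) :* s :+ h) :- (con (+ 1) :- d) :* s := h) ≈-refl (δ k) (S z) (η z k) ⟩
    η z k                                          ∎

  δ*walks-diagonal : ∀ a → a < k → δ k * walks k a a ≈ ω a * π a k
  δ*walks-diagonal a a<k with even a in e
  ... | true = begin
    δ k * walks k a a          ≈⟨ *-congˡ (walks-free a e) ⟩
    δ k * (1# + X * S a)       ≈⟨ solve 3 (λ d x s → d :* (con (+ 1) :+ x :* s) := d :+ x :* (d :* s)) ≈-refl (δ k) X (S a) ⟩
    δ k + X * (δ k * S a)      ≈⟨ +-congˡ (*-congˡ (δ*S a)) ⟩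
    δ k + X * η a k            ≈⟨ +-congˡ (X*η a k) ⟩
    δ k + (π a k - δ k)        ≈⟨ solve 2 (λ d p → d :+ (p :- d) := con (+ 1) :* p) ≈-refl (δ k) (π a k) ⟩
    1# * π a k                 ∎
  ... | false = begin
    δ k * walks k a a
      ≈⟨ *-congˡ (walks-restricted a e a≤k) ⟩
    δ k * (const (indicator (a ≤ᵇ a)) + X * (S a - H a a))
      ≈⟨ *-congˡ (+-cong (reflexive (cong (const ∘ indicator) a≤ᵇa)) (*-congˡ (+-congˡ (-‿cong (H-sweep a a a≤k))))) ⟩
    δ k * (1# + X * (S a - ((1# - δ a) * S a + η a a)))
      ≈⟨ solve 5 (λ dk da x s h → dk :* (con (+ 1) :+ x :* (s :- ((con (+ 1) :- da) :* s :+ h)))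
                                 := dk :+ da :* (x :* (dk :* s)) :- dk :* (x :* h)) ≈-refl (δ k) (δ a) X (S a) (η a a) ⟩
    δ k + δ a * (X * (δ k * S a)) - δ k * (X * η a a)
      ≈⟨ +-cong (+-congˡ (*-congˡ (≈-trans (*-congˡ (δ*S a)) (X*η a k)))) (-‿cong (*-congˡ (X*η-below {a} ℕ.≤-refl))) ⟩
    δ k + δ a * (π a k - δ k) - δ k * (1# - δ a)
      ≈⟨ solve 3 (λ dk da p → dk :+ da :* (p :- dk) :- dk :* (con (+ 1) :- da) := da :* p) ≈-refl (δ k) (δ a) (π a k) ⟩
    δ a * π a k ∎
    where
    a≤k = ℕ.<⇒≤ a<k
    a≤ᵇa = Equivalence.to T-≡ (ℕ.≤⇒≤ᵇ (ℕ.≤-refl {a}))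

  F-as-trace : F k ≈ 1# + X * ∑ₚ k (λ a → walks k a a)
  F-as-trace = ≈const+X* refl (count-CWEU k)

  δ*F : δ k * F k ≈ δ k + X * R k
  δ*F = begin
    δ k * F k                                      ≈⟨ *-congˡ F-as-trace ⟩
    δ k * (1# + X * ∑ₚ k (λ a → walks k a a))
      ≈⟨ solve 3 (λ d x t → d :* (con (+ 1) :+ x :* t) := d :+ x :* (d :* t)) ≈-refl (δ k) X (∑ₚ k (λ a → walks k a a)) ⟩
    δ k + X * (δ k * ∑ₚ k (λ a → walks k a a))    ≈⟨ +-congˡ (*-congˡ (*-distribˡ-∑ₚ k (δ k) (λ a → walks k a a))) ⟩
    δ k + X * ∑ₚ k (λ a → δ k * walks k a a)      ≈⟨ +-congˡ (*-congˡ (∑ₚ-cong k δ*walks-diagonal)) ⟩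
    δ k + X * R k                                  ∎

R-suc-free : ∀ t → even t ≡ true → R (suc t) ≈ R t + 1#
R-suc-free t e = begin
  R (suc t)                                              ≈⟨ ∑ₚ-snoc t (λ a → ω a * π a (suc t)) ⟩
  ∑ₚ t (λ a → ω a * π a (suc t)) + ω t * π t (suc t)
    ≈⟨ +-cong (∑ₚ-cong t (λ a a<t → *-congˡ (reflexive (π-suc-free a<t e))))
              (reflexive (cong₂ _*_ (cong (λ b → if b then 1# else δ t) e) (π≡1# {t} ℕ.≤-refl))) ⟩
  R t + 1# * 1#                                          ≈⟨ +-congˡ (*-identityˡ 1#) ⟩
  R t + 1#                                               ∎

R-suc-restricted : ∀ t → even t ≡ false → R (suc t) ≈ 1-X * R t + δ t
R-suc-restricted t e = begin
  R (suc t)                                              ≈⟨ ∑ₚ-snoc t (λ a → ω a * π a (suc t)) ⟩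
  ∑ₚ t (λ a → ω a * π a (suc t)) + ω t * π t (suc t)
    ≈⟨ +-cong (∑ₚ-cong t (λ a a<t → *-congˡ (reflexive (π-suc-restricted a<t e))))
              (reflexive (cong₂ _*_ (cong (λ b → if b then 1# else δ t) e) (π≡1# {t} ℕ.≤-refl))) ⟩
  ∑ₚ t (λ a → ω a * (1-X * π a t)) + δ t * 1#
    ≈⟨ +-cong (∑ₚ-cong t (λ a _ → x∙yz≈y∙xz (ω a) 1-X (π a t))) (*-identityʳ (δ t)) ⟩
  ∑ₚ t (λ a → 1-X * (ω a * π a t)) + δ t               ≈⟨ +-congʳ (≈-sym (*-distribˡ-∑ₚ t 1-X (λ a → ω a * π a t))) ⟩
  1-X * R t + δ t                                        ∎

double : ℕ → ℕ
double zero    = zero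
double (suc c) = suc (suc (double c))

even-double : ∀ c → even (double c) ≡ true
even-double zero    = refl
even-double (suc c) = even-double c

even-suc-double : ∀ c → even (suc (double c)) ≡ false
even-suc-double zero    = refl
even-suc-double (suc c) = even-suc-double c

data Parity : ℕ → Set where
  is-double     : ∀ c → Parity (double c)
  is-suc-double : ∀ c → Parity (suc (double c))

parity : ∀ k → Parity k
parity zero = is-double 0
parity (suc k) with parity k
... | is-double c     = is-suc-double c
... | is-suc-double c = is-double (suc c)

⌊double/2⌋ : ∀ c → ⌊ double c /2⌋ ≡ c
⌊double/2⌋ zero    = refl
⌊double/2⌋ (suc c) = cong suc (⌊double/2⌋ c)

⌈double/2⌉ : ∀ c → ⌈ double c /2⌉ ≡ c
⌈double/2⌉ zero    = refl
⌈double/2⌉ (suc c) = cong suc (⌈double/2⌉ c)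

1-X^ : ℕ → PS
1-X^ zero    = 1#
1-X^ (suc c) = 1-X * 1-X^ c

δ-double     : ∀ c → δ (double c) ≈ (1# + 1-X) * 1-X^ c - 1-X
δ-suc-double : ∀ c → δ (suc (double c)) ≈ (1# + 1-X) * 1-X^ c - 1#

δ-double zero = solve 1 (λ y → con (+ 1) := (con (+ 1) :+ y) :* con (+ 1) :- y) ≈-refl 1-X
δ-double (suc c) rewrite even-suc-double c = begin
  1-X * δ (suc (double c))                         ≈⟨ *-congˡ (δ-suc-double c) ⟩
  1-X * ((1# + 1-X) * 1-X^ c - 1#)
    ≈⟨ solve 2 (λ y p → y :* ((con (+ 1) :+ y) :* p :- con (+ 1)) := (con (+ 1) :+ y) :* (y :* p) :- y) ≈-refl 1-X (1-X^ c) ⟩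
  (1# + 1-X) * 1-X^ (suc c) - 1-X                  ∎

δ-suc-double c rewrite even-double c = begin
  δ (double c) - X                                 ≈⟨ +-congʳ (δ-double c) ⟩
  ((1# + 1-X) * 1-X^ c - 1-X) - X
    ≈⟨ solve 2 (λ x p → let y = con (+ 1) :- x in ((con (+ 1) :+ y) :* p :- y) :- x := (con (+ 1) :+ y) :* p :- con (+ 1))
               ≈-refl X (1-X^ c) ⟩
  (1# + 1-X) * 1-X^ c - 1#                         ∎

const-suc : ∀ c → const (+ suc c) ≈ const (+ c) + 1#
const-suc c = ≈-trans (reflexive (cong (const ∘ +_) (ℕ.+-comm 1 c))) (const-+ₚ (+ c) (+ 1))

R-double     : ∀ c → 1-X * R (double c) ≈ const (+ c) * 1-X^ c + (const (+ c) + 1#) * (1-X * 1-X^ c) - 1-X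
R-suc-double : ∀ c → 1-X * R (suc (double c)) ≈ const (+ c) * 1-X^ c + (const (+ c) + 1#) * (1-X * 1-X^ c)

R-double zero = begin
  1-X * R 0        ≈⟨ *-congˡ (∑ₚ-zero (λ a → ω a * π a 0)) ⟩
  1-X * 0#         ≈⟨ solve 1 (λ y → y :* con (+ 0) := con (+ 0) :* con (+ 1) :+ (con (+ 0) :+ con (+ 1)) :* (y :* con (+ 1)) :- y)
                        ≈-refl 1-X ⟩
  const (+ 0) * 1# + (const (+ 0) + 1#) * (1-X * 1#) - 1-X ∎
R-double (suc c) = begin
  1-X * R (suc (suc (double c)))
    ≈⟨ *-congˡ (R-suc-restricted (suc (double c)) (even-suc-double c)) ⟩
  1-X * (1-X * R (suc (double c)) + δ (suc (double c)))
    ≈⟨ *-congˡ (+-cong (R-suc-double c) (δ-suc-double c)) ⟩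
  1-X * ((const (+ c) * 1-X^ c + (const (+ c) + 1#) * (1-X * 1-X^ c)) + ((1# + 1-X) * 1-X^ c - 1#))
    ≈⟨ solve 3 (λ y p n → y :* ((n :* p :+ (n :+ con (+ 1)) :* (y :* p)) :+ ((con (+ 1) :+ y) :* p :- con (+ 1)))
                         := (n :+ con (+ 1)) :* (y :* p) :+ ((n :+ con (+ 1)) :+ con (+ 1)) :* (y :* (y :* p)) :- y)
               ≈-refl 1-X (1-X^ c) (const (+ c)) ⟩
  (const (+ c) + 1#) * 1-X^ (suc c) + ((const (+ c) + 1#) + 1#) * (1-X * 1-X^ (suc c)) - 1-X
    ≈⟨ ≈-sym (+-congʳ (+-cong (*-congʳ (const-suc c)) (*-congʳ (+-congʳ (const-suc c))))) ⟩
  const (+ suc c) * 1-X^ (suc c) + (const (+ suc c) + 1#) * (1-X * 1-X^ (suc c)) - 1-X ∎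

R-suc-double c = begin
  1-X * R (suc (double c))                 ≈⟨ *-congˡ (R-suc-free (double c) (even-double c)) ⟩
  1-X * (R (double c) + 1#)                ≈⟨ solve 2 (λ y r → y :* (r :+ con (+ 1)) := y :* r :+ y) ≈-refl 1-X (R (double c)) ⟩
  1-X * R (double c) + 1-X                 ≈⟨ +-congʳ (R-double c) ⟩
  (const (+ c) * 1-X^ c + (const (+ c) + 1#) * (1-X * 1-X^ c) - 1-X) + 1-X
    ≈⟨ solve 3 (λ y p n → (n :* p :+ (n :+ con (+ 1)) :* (y :* p) :- y) :+ y := n :* p :+ (n :+ con (+ 1)) :* (y :* p))
               ≈-refl 1-X (1-X^ c) (const (+ c)) ⟩
  const (+ c) * 1-X^ c + (const (+ c) + 1#) * (1-X * 1-X^ c) ∎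

⊕≈+ : ∀ {a a′ b b′} → a ≈ a′ → b ≈ b′ → a ⊕ b ≈ a′ + b′
⊕≈+ {a} {b = b} a≈a′ b≈b′ = ≈-trans (reflexive (⊕≡+ₚ a b)) (+-cong a≈a′ b≈b′)

⊛≈* : ∀ {a a′ b b′} → a ≈ a′ → b ≈ b′ → a ⊛ b ≈ a′ * b′
⊛≈* {a} {b = b} a≈a′ b≈b′ = ≈-trans (reflexive (⊛≡*ₚ a b)) (*-cong a≈a′ b≈b′)

scale≈const* : ∀ c a → scale c a ≈ const c * a
scale≈const* c a = coeffwise λ n → ≡.sym (const*ₚ-coeff c a n)

scale-1≈- : ∀ a → scale ℤ.-1ℤ a ≈ - a
scale-1≈- a = ≈-trans (scale≈const* ℤ.-1ℤ a) (solve 1 (λ x → con ℤ.-1ℤ :* x := :- x) ≈-refl a)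

oneMinusX≈1-X : oneMinusX ≈ 1-X
oneMinusX≈1-X = ⊕≈+ ≈-refl (scale-1≈- X)

^ps≈1-X^ : ∀ c → oneMinusX ^ps c ≈ 1-X^ c
^ps≈1-X^ zero    = ≈-refl
^ps≈1-X^ (suc c) = ⊛≈* oneMinusX≈1-X (^ps≈1-X^ c)

den num : ℕ → PS
den c = (const (+ 2) - X) * 1-X^ c + X - 1#
num c = const (+ 2) * 1-X^ c + const (+ c) * X - 1#

Den≈den : ∀ c → Den c ≈ den c
Den≈den c = ⊕≈+ (⊕≈+ (⊛≈* (⊕≈+ ≈-refl (scale-1≈- X)) (^ps≈1-X^ c)) ≈-refl) (const--ₚ (+ 1))

Num≈num : ∀ c → Num c ≈ num c
Num≈num c = ⊕≈+ (⊕≈+ (≈-trans (scale≈const* (+ 2) (oneMinusX ^ps c)) (*-congˡ (^ps≈1-X^ c))) (scale≈const* (+ c) X))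
                (const--ₚ (+ 1))

theorem7-lhs≈ : ∀ k c → F k ⊛ (oneMinusX ⊛ Den c) ≈ F k * (1-X * den c)
theorem7-lhs≈ k c = ⊛≈* ≈-refl (⊛≈* oneMinusX≈1-X (Den≈den c))

theorem7-rhs≈ : ∀ e c → scale (+ e) (X ⊛ Den c) ⊕ (Num c ⊛ oneMinusX) ≈ const (+ e) * (X * den c) + num c * 1-X
theorem7-rhs≈ e c = ⊕≈+ (≈-trans (scale≈const* (+ e) (X ⊛ Den c)) (*-congˡ (⊛≈* ≈-refl (Den≈den c))))
                        (⊛≈* (Num≈num c) oneMinusX≈1-X)

den≈δ-double : ∀ c → den c ≈ δ (double c)
den≈δ-double c = ≈-trans (solve 2 (λ x p → let y = con (+ 1) :- x in
                                     (con (+ 2) :- x) :* p :+ x :- con (+ 1) := (con (+ 1) :+ y) :* p :- y)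
                                   ≈-refl X (1-X^ c))
                         (≈-sym (δ-double c))

den≈1-X*δ-suc-double : ∀ c → den (suc c) ≈ 1-X * δ (suc (double c))
den≈1-X*δ-suc-double c = ≈-trans (solve 2 (λ x p → let y = con (+ 1) :- x in
                                             (con (+ 2) :- x) :* (y :* p) :+ x :- con (+ 1) := y :* ((con (+ 1) :+ y) :* p :- con (+ 1)))
                                           ≈-refl X (1-X^ c))
                                 (*-congˡ (≈-sym (δ-suc-double c)))

theorem7-double : ∀ c → F (double c) ⊛ (oneMinusX ⊛ Den c) ≈ scale (+ c) (X ⊛ Den c) ⊕ (Num c ⊛ oneMinusX)
theorem7-double c = begin
  F k ⊛ (oneMinusX ⊛ Den c)           ≈⟨ theorem7-lhs≈ k c ⟩
  F k * (1-X * den c)                 ≈⟨ *-congˡ (*-congˡ (den≈δ-double c)) ⟩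
  F k * (1-X * δ k)                   ≈⟨ solve 3 (λ f y d → f :* (y :* d) := y :* (d :* f)) ≈-refl (F k) 1-X (δ k) ⟩
  1-X * (δ k * F k)                   ≈⟨ *-congˡ δ*F ⟩
  1-X * (δ k + X * R k)               ≈⟨ solve 4 (λ x y d r → y :* (d :+ x :* r) := y :* d :+ x :* (y :* r)) ≈-refl X 1-X (δ k) (R k) ⟩
  1-X * δ k + X * (1-X * R k)         ≈⟨ +-cong (*-congˡ (δ-double c)) (*-congˡ (R-double c)) ⟩
  1-X * ((1# + 1-X) * 1-X^ c - 1-X) + X * (const (+ c) * 1-X^ c + (const (+ c) + 1#) * (1-X * 1-X^ c) - 1-X)
    ≈⟨ solve 3 (λ x p n → let y = con (+ 1) :- x in
                 y :* ((con (+ 1) :+ y) :* p :- y) :+ x :* (n :* p :+ (n :+ con (+ 1)) :* (y :* p) :- y)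
                 := n :* (x :* ((con (+ 2) :- x) :* p :+ x :- con (+ 1))) :+ (con (+ 2) :* p :+ n :* x :- con (+ 1)) :* y)
               ≈-refl X (1-X^ c) (const (+ c)) ⟩
  const (+ c) * (X * den c) + num c * 1-X     ≈⟨ ≈-sym (theorem7-rhs≈ c c) ⟩
  scale (+ c) (X ⊛ Den c) ⊕ (Num c ⊛ oneMinusX) ∎
  where
  k = double c
  open Sweep k

theorem7-suc-double : ∀ c →
  F (suc (double c)) ⊛ (oneMinusX ⊛ Den (suc c)) ≈ scale (+ c) (X ⊛ Den (suc c)) ⊕ (Num (suc c) ⊛ oneMinusX)
theorem7-suc-double c = begin
  F k ⊛ (oneMinusX ⊛ Den (suc c))     ≈⟨ theorem7-lhs≈ k (suc c) ⟩
  F k * (1-X * den (suc c))           ≈⟨ *-congˡ (*-congˡ (den≈1-X*δ-suc-double c)) ⟩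
  F k * (1-X * (1-X * δ k))           ≈⟨ solve 3 (λ f y d → f :* (y :* (y :* d)) := y :* (y :* (d :* f))) ≈-refl (F k) 1-X (δ k) ⟩
  1-X * (1-X * (δ k * F k))           ≈⟨ *-congˡ (*-congˡ δ*F) ⟩
  1-X * (1-X * (δ k + X * R k))
    ≈⟨ solve 4 (λ x y d r → y :* (y :* (d :+ x :* r)) := y :* (y :* d) :+ x :* (y :* (y :* r))) ≈-refl X 1-X (δ k) (R k) ⟩
  1-X * (1-X * δ k) + X * (1-X * (1-X * R k))
    ≈⟨ +-cong (*-congˡ (*-congˡ (δ-suc-double c))) (*-congˡ (*-congˡ (R-suc-double c))) ⟩
  1-X * (1-X * ((1# + 1-X) * 1-X^ c - 1#)) + X * (1-X * (const (+ c) * 1-X^ c + (const (+ c) + 1#) * (1-X * 1-X^ c)))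
    ≈⟨ solve 3 (λ x p n → let y = con (+ 1) :- x in
                 y :* (y :* ((con (+ 1) :+ y) :* p :- con (+ 1))) :+ x :* (y :* (n :* p :+ (n :+ con (+ 1)) :* (y :* p)))
                 := n :* (x :* ((con (+ 2) :- x) :* (y :* p) :+ x :- con (+ 1)))
                    :+ (con (+ 2) :* (y :* p) :+ (n :+ con (+ 1)) :* x :- con (+ 1)) :* y)
               ≈-refl X (1-X^ c) (const (+ c)) ⟩
  const (+ c) * (X * den (suc c)) + (const (+ 2) * 1-X^ (suc c) + (const (+ c) + 1#) * X - 1#) * 1-X
    ≈⟨ +-congˡ (*-congʳ (+-congʳ (+-congˡ (*-congʳ (≈-sym (const-suc c)))))) ⟩
  const (+ c) * (X * den (suc c)) + num (suc c) * 1-X   ≈⟨ ≈-sym (theorem7-rhs≈ c (suc c)) ⟩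
  scale (+ c) (X ⊛ Den (suc c)) ⊕ (Num (suc c) ⊛ oneMinusX) ∎
  where
  k = suc (double c)
  open Sweep k

theorem7 : (k : ℕ) → 2 ≤ k → (n : ℕ) →
    (F k ⊛ (oneMinusX ⊛ Den ⌈ k /2⌉)) n
    ≡ (scale (+ ⌊ k /2⌋) (X ⊛ Den ⌈ k /2⌉) ⊕ (Num ⌈ k /2⌉ ⊛ oneMinusX)) n
theorem7 k _ n with parity k
... | is-double c     rewrite ⌊double/2⌋ c | ⌈double/2⌉ c = coeff (theorem7-double c) n
... | is-suc-double c rewrite ⌊double/2⌋ c | ⌈double/2⌉ c = coeff (theorem7-suc-double c) n
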